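{- Let $q$ be a prime power with $q\equiv5\pmod 8$. Then $T_{\mathbb{F}_q}^{\mathrm{adv}_\infty}=\{k\in T_{\mathbb{F}_q} : 4k(1+k)^2 \text{ is a fourth power in } \mathbb{F}_q\}$.
   Context: For a field $K$ of characteristic not $2$, let $T_K=K\setminus\{0,1,-1\}$. For $k_1,k_2\in T_K$ write $k_1\overset{k}{\mapsto}k_2$ if $(1+k_1)^2k_2^2=4k_1$. For $n\ge0$, $T_K^{\mathrm{adv}_n}$ is the set of $k_0\in T_K$ for which there exist $k_1,\dots,k_n\in T_K$ with $k_0\overset{k}{\mapsto}k_1\overset{k}{\mapsto}\cdots\overset{k}{\mapsto}k_n$, and $T_K^{\mathrm{adv}_\infty}=\bigcap_{n\ge0}T_K^{\mathrm{adv}_n}$. -}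

module Defs where

open import Level using (Level; _⊔_)
open import Algebra.Bundles using (CommutativeRing)
open import Data.Nat using (ℕ; zero; suc; _^_; _≥_)
open import Data.Nat.Primality using (Prime)
open import Data.Fin using (Fin)
open import Data.Product using (Σ; ∃; _×_; _,_)
open import Relation.Nullary using (¬_)
open import Relation.Binary.PropositionalEquality using (_≡_)
import Relation.Binary.PropositionalEquality as ≡
open import Function.Bundles using (Bijection)

IsPrimePower : ℕ → Set
IsPrimePower q = Σ ℕ λ p → Σ ℕ λ m → Prime p × m ≥ 1 × q ≡ p ^ m

module _ {c ℓ : Level} (R : CommutativeRing c ℓ) where
  open CommutativeRing R

  IsField : Set (c ⊔ ℓ)
  IsField = (¬ (1# ≈ 0#)) × (∀ x → ¬ (x ≈ 0#) → ∃ λ y → x * y ≈ 1#)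

  HasCard : ℕ → Set (c ⊔ ℓ)
  HasCard q = Bijection setoid (≡.setoid (Fin q))

  two four : Carrier
  two = 1# + 1#
  four = two + two

  sq : Carrier → Carrier
  sq x = x * x

  CharNot2 : Set ℓ
  CharNot2 = ¬ (two ≈ 0#)

  T : Carrier → Set ℓ
  T k = (¬ (k ≈ 0#)) × (¬ (k ≈ 1#)) × (¬ (k ≈ - 1#))

  _↦_ : Carrier → Carrier → Set ℓ
  k₁ ↦ k₂ = T k₁ × T k₂ × (sq (1# + k₁) * sq k₂ ≈ four * k₁)

  Adv : ℕ → Carrier → Set (c ⊔ ℓ)
  Adv zero k = Level.Lift c (T k)
  Adv (suc n) k = ∃ λ k' → (k ↦ k') × Adv n k'

  AdvInf : Carrier → Set (c ⊔ ℓ)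
  AdvInf k = ∀ n → Adv n k

  IsFourthPower : Carrier → Set (c ⊔ ℓ)
  IsFourthPower x = ∃ λ y → x ≈ sq (sq y)

{-# OPTIONS --safe #-}

-- Write Δ(k) = 4k(1+k)². Over any field of characteristic ≠ 2, a step k₁ ↦ k₂ forces
-- k₁ = ((1+k₁)k₂/2)² to be a square w², and then k ↦ k₁ gives Δ(k) = ((1+k)²k₁)² = ((1+k)w)⁴.
-- Conversely, if Δ(k) = y⁴ then k₁ = (y/(1+k))² is a square with k ↦ k₁. So it suffices that
-- a square successor k₁ = s² of k always has a square successor itself, after possibly
-- replacing k₁ by −k₁ (also a successor of k). With A = 2s(1+k₁) and B = 2s(1−k₁) one has
-- Δ(k₁) = A², Δ(−k₁) = (ζB)² where ζ² = −1, and AB(1+k)² = (2s(1−k))². When q ≡ 5 (mod 8),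
-- −1 = ζ² is a square but ζ is not, and the nonzero squares have index 2 in F*. So either A is
-- a square, or ζA is and then so is ζB, as AB is a square; that is, Δ(k₁) or Δ(−k₁) is a
-- fourth power.
--
-- The facts about F_q come from counting with fixed-point-free involutions: x ↦ x + 1 shows
-- that 2 ≠ 0 when q is odd; x ↦ −x pairs up F*, and squaring matches the pairs with the
-- (q−1)/2 nonzero squares; x ↦ x⁻¹ on the squares other than 1 shows that −1 is a square
-- when q ≡ 1 (mod 4); and if ζ were a square, −1 would be a fourth power, so x ↦ −x would
-- pair up the (q−1)/4 nonzero fourth powers and force q ≡ 1 (mod 8).

module Submission where

open import Defs
open import Algebra.Bundles using (CommutativeRing)
open import Data.Nat using (ℕ; _%_)
open import Data.Product using (_×_)
open import Relation.Binary.PropositionalEquality using (_≡_)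
open import Function.Bundles using (_⇔_)
open import Data.Empty using (⊥; ⊥-elim)
open import Data.Fin.Base using (Fin)
open import Data.Nat.Divisibility using (divides)
open import Data.Nat.DivMod using (m∣n⇒o%n%m≡o%m)
open import Data.Product using (∃; _,_; proj₁; proj₂; map₂)
open import Data.Sum using (_⊎_; inj₁; inj₂)
open import Data.Unit using (tt)
open import Function.Base using (id; _∘_)
open import Function.Bundles using (Bijection; mk⇔)
open import Level using (Level; 0ℓ; _⊔_; lift)
open import Relation.Binary.Bundles using (Setoid)
open import Relation.Binary.Definitions using (_Respects_) renaming (Decidable to Decidable₂)
import Relation.Binary.PropositionalEquality as ≡
open import Relation.Nullary using (¬_; Dec; yes; no; ¬?; _×-dec_)
open import Relation.Unary using (Pred; Decidable; ∁; _∩_)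
open import Relation.Unary.Properties using (∁?; _∩?_; U?)

module Counting where

  open import Data.Bool.Base using (if_then_else_)
  open import Data.Fin.Base using (zero; suc; _<_)
  open import Data.Fin.Properties using (_≟_; _<?_; <-asym; <-cmp; suc-injective; 0≢1+n)
  open import Data.Nat.Base using (zero; suc; _+_; _≤_; z≤n; s≤s)
  open import Data.Nat.Properties using (+-suc; ≤-antisym; ≤-trans; ≤-reflexive)
  open import Relation.Binary.Definitions using (tri<; tri≈; tri>)
  open import Relation.Binary.PropositionalEquality using (_≢_; refl; sym; trans; cong; subst)
  open import Relation.Nullary using (does)

  private
    variable
      p r : Level

  count : ∀ {n} {P : Pred (Fin n) p} → Decidable P → ℕ
  count {n = zero}  P? = 0
  count {n = suc n} P? = (if does (P? zero) then 1 else 0) + count (P? ∘ suc)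

  count-cong : ∀ {n} {P : Pred (Fin n) p} {Q : Pred (Fin n) r} (P? : Decidable P) (Q? : Decidable Q) →
               (∀ {i} → P i → Q i) → (∀ {i} → Q i → P i) → count P? ≡ count Q?
  count-cong {n = zero}  P? Q? P⇒Q Q⇒P = refl
  count-cong {n = suc n} P? Q? P⇒Q Q⇒P with P? zero | Q? zero
  ... | yes _  | yes _  = cong suc (count-cong (P? ∘ suc) (Q? ∘ suc) P⇒Q Q⇒P)
  ... | yes p₀ | no ¬q₀ = ⊥-elim (¬q₀ (P⇒Q p₀))
  ... | no ¬p₀ | yes q₀ = ⊥-elim (¬p₀ (Q⇒P q₀))
  ... | no _   | no _   = count-cong (P? ∘ suc) (Q? ∘ suc) P⇒Q Q⇒P

  count-universal : ∀ {n} {P : Pred (Fin n) p} (P? : Decidable P) → (∀ i → P i) → count P? ≡ n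
  count-universal {n = zero}  P? all = refl
  count-universal {n = suc n} P? all with P? zero
  ... | yes _  = cong suc (count-universal (P? ∘ suc) (all ∘ suc))
  ... | no ¬p₀ = ⊥-elim (¬p₀ (all zero))

  count-split : ∀ {n} {P : Pred (Fin n) p} {R : Pred (Fin n) r} (P? : Decidable P) (R? : Decidable R) →
                count P? ≡ count (P? ∩? R?) + count (P? ∩? ∁? R?)
  count-split {n = zero}  P? R? = refl
  count-split {n = suc n} P? R? with P? zero | R? zero
  ... | yes _ | yes _ = cong suc (count-split (P? ∘ suc) (R? ∘ suc))
  ... | yes _ | no _  = trans (cong suc (count-split (P? ∘ suc) (R? ∘ suc))) (sym (+-suc _ _))
  ... | no _  | yes _ = count-split (P? ∘ suc) (R? ∘ suc)
  ... | no _  | no _  = count-split (P? ∘ suc) (R? ∘ suc)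

  private
    count-∖-suc : ∀ {n} {P : Pred (Fin (suc n)) p} (P? : Decidable P) (j : Fin n) →
                  count ((P? ∘ suc) ∩? ∁? (_≟ j)) ≡ count ((P? ∩? ∁? (_≟ suc j)) ∘ suc)
    count-∖-suc P? j = count-cong ((P? ∘ suc) ∩? ∁? (_≟ j)) ((P? ∩? ∁? (_≟ suc j)) ∘ suc)
                                  (map₂ (_∘ suc-injective)) (map₂ (_∘ cong suc))

  count-remove : ∀ {n} {P : Pred (Fin n) p} (P? : Decidable P) {j : Fin n} →
                 P j → count P? ≡ suc (count (P? ∩? ∁? (_≟ j)))
  count-remove {n = suc n} P? {zero} p₀ with P? zero
  ... | yes _  = cong suc (count-cong (P? ∘ suc) _ (_, λ ()) proj₁)
  ... | no ¬p₀ = ⊥-elim (¬p₀ p₀)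
  count-remove {n = suc n} P? {suc j} pj with P? zero
  ... | yes _ = cong suc (trans (count-remove (P? ∘ suc) pj) (cong suc (count-∖-suc P? j)))
  ... | no _  = trans (count-remove (P? ∘ suc) pj) (cong suc (count-∖-suc P? j))

  count-injection : ∀ {n m} {P : Pred (Fin n) p} {Q : Pred (Fin m) r}
                    (P? : Decidable P) (Q? : Decidable Q) (f : Fin n → Fin m) →
                    (∀ {i} → P i → Q (f i)) → (∀ {i j} → P i → P j → f i ≡ f j → i ≡ j) →
                    count P? ≤ count Q?
  count-injection {n = zero}  P? Q? f maps inj = z≤n
  count-injection {n = suc n} P? Q? f maps inj with P? zero
  ... | no _   = count-injection (P? ∘ suc) Q? (f ∘ suc) maps
                   (λ pi pj → suc-injective ∘ inj pi pj)
  ... | yes p₀ = ≤-trans (s≤s rest) (≤-reflexive (sym (count-remove Q? (maps p₀))))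
    where
      rest : count (P? ∘ suc) ≤ count (Q? ∩? ∁? (_≟ f zero))
      rest = count-injection (P? ∘ suc) (Q? ∩? ∁? (_≟ f zero)) (f ∘ suc)
               (λ pi → maps pi , λ fi≡f₀ → 0≢1+n (sym (inj pi p₀ fi≡f₀)))
               (λ pi pj → suc-injective ∘ inj pi pj)

  count-involution : ∀ {n} {P : Pred (Fin n) p} (P? : Decidable P) (f : Fin n → Fin n) →
                     (∀ {i} → P i → P (f i)) → (∀ {i} → P i → f (f i) ≡ i) → (∀ {i} → P i → f i ≢ i) →
                     let H? = P? ∩? (λ i → i <? f i) in count P? ≡ count H? + count H?
  count-involution {P = P} P? f closed involutive fixed-point-free =
    trans (count-split P? (λ i → i <? f i)) (cong (count H? +_) (≤-antisym below above))
    where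
      H? : Decidable (P ∩ λ i → i < f i)
      H? = P? ∩? (λ i → i <? f i)
      injective : ∀ {i j} → P i → P j → f i ≡ f j → i ≡ j
      injective {i} {j} pi pj fi≡fj = trans (sym (involutive pi)) (trans (cong f fi≡fj) (involutive pj))
      image-precedes : ∀ {i} → P i → ¬ i < f i → f i < f (f i)
      image-precedes {i} pi i≮fi with <-cmp i (f i)
      ... | tri< i<fi _ _ = ⊥-elim (i≮fi i<fi)
      ... | tri≈ _ i≡fi _ = ⊥-elim (fixed-point-free pi (sym i≡fi))
      ... | tri> _ _ fi<i = subst (f i <_) (sym (involutive pi)) fi<i
      below : count (P? ∩? ∁? (λ i → i <? f i)) ≤ count H?
      below = count-injection (P? ∩? ∁? (λ i → i <? f i)) H? f
                (λ (pi , i≮fi) → closed pi , image-precedes pi i≮fi)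
                (λ pi pj → injective (proj₁ pi) (proj₁ pj))
      above : count H? ≤ count (P? ∩? ∁? (λ i → i <? f i))
      above = count-injection H? (P? ∩? ∁? (λ i → i <? f i)) f
                (λ (pi , i<fi) → closed pi , λ fi<ffi → <-asym i<fi (subst (f _ <_) (involutive pi) fi<ffi))
                (λ pi pj → injective (proj₁ pi) (proj₁ pj))

module FiniteSetoid {a ℓ n} (S : Setoid a ℓ) (card : Bijection S (≡.setoid (Fin n))) where

  open Counting
  open import Data.Fin.Base using (_<_)
  open import Data.Fin.Properties as Fin using (_<?_; any?)
  open import Data.Nat.Base using (suc; _+_; _≤_)
  open import Function.Bundles using (Inverse)
  open import Function.Definitions using (Congruent)
  open import Function.Properties.Bijection using (Bijection⇒Inverse)
  open import Relation.Binary.Definitions using (tri<; tri≈; tri>)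
  open import Relation.Binary.PropositionalEquality using (_≢_)
  import Relation.Nullary.Decidable as Dec

  open Setoid S
  open Bijection card using (injective)
  open Inverse (Bijection⇒Inverse card) using (to; from; to-cong; strictlyInverseˡ; strictlyInverseʳ)

  private
    variable
      p : Level
      P Q R : Pred Carrier p

    from-to : ∀ {i x} → i ≡ to x → from i ≈ x
    from-to {x = x} ≡.refl = strictlyInverseʳ x

    to-from : ∀ {i x} → from i ≈ x → i ≡ to x
    to-from {i} e = ≡.trans (≡.sym (strictlyInverseˡ i)) (to-cong e)

    from-injective : ∀ {i j} → from i ≈ from j → i ≡ j
    from-injective {j = j} e = ≡.trans (to-from e) (strictlyInverseˡ j)

  _≟_ : Decidable₂ _≈_
  x ≟ y = Dec.map′ injective to-cong (to x Fin.≟ to y)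

  ∃? : P Respects _≈_ → Decidable P → Dec (∃ P)
  ∃? resp P? = Dec.map′ (λ (i , p) → from i , p) (λ (x , p) → to x , resp (sym (strictlyInverseʳ x)) p)
                        (any? (P? ∘ from))

  ∣_∣ : Decidable P → ℕ
  ∣ P? ∣ = count (P? ∘ from)

  ∣∣-cong : (P? : Decidable P) (Q? : Decidable Q) → (∀ {x} → P x → Q x) → (∀ {x} → Q x → P x) →
            ∣ P? ∣ ≡ ∣ Q? ∣
  ∣∣-cong P? Q? P⇒Q Q⇒P = count-cong (P? ∘ from) (Q? ∘ from) P⇒Q Q⇒P

  ∣∣-universal : (P? : Decidable P) → (∀ x → P x) → ∣ P? ∣ ≡ n
  ∣∣-universal P? all = count-universal (P? ∘ from) (all ∘ from)

  ∣∣-split : (P? : Decidable P) (R? : Decidable R) → ∣ P? ∣ ≡ ∣ P? ∩? R? ∣ + ∣ P? ∩? ∁? R? ∣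
  ∣∣-split P? R? = count-split (P? ∘ from) (R? ∘ from)

  ∣∣-remove : (P? : Decidable P) → P Respects _≈_ → ∀ {x} → P x → ∣ P? ∣ ≡ suc ∣ P? ∩? ∁? (_≟ x) ∣
  ∣∣-remove P? resp {x} px = ≡.trans (count-remove (P? ∘ from) (resp (sym (strictlyInverseʳ x)) px))
    (≡.cong suc (count-cong ((P? ∘ from) ∩? ∁? (Fin._≟ to x)) ((P? ∩? ∁? (_≟ x)) ∘ from)
                                (map₂ (_∘ to-from)) (map₂ (_∘ from-to))))

  ∣∣-injection : (P? : Decidable P) (Q? : Decidable Q) → Q Respects _≈_ → (f : Carrier → Carrier) →
                 (∀ {x} → P x → Q (f x)) → (∀ {x y} → P x → P y → f x ≈ f y → x ≈ y) → ∣ P? ∣ ≤ ∣ Q? ∣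
  ∣∣-injection P? Q? resp f maps inj = count-injection (P? ∘ from) (Q? ∘ from) (to ∘ f ∘ from)
    (λ p → resp (sym (strictlyInverseʳ _)) (maps p))
    (λ pi pj e → from-injective (inj pi pj (injective e)))

  infix 4 _≺_ _≺?_

  _≺_ : Carrier → Carrier → Set
  x ≺ y = to x < to y

  _≺?_ : Decidable₂ _≺_
  x ≺? y = to x <? to y

  ≺-resp : ∀ {x x′ y y′} → x ≈ x′ → y ≈ y′ → x ≺ y → x′ ≺ y′
  ≺-resp x≈x′ y≈y′ = ≡.subst₂ _<_ (to-cong x≈x′) (to-cong y≈y′)

  ≺-asym : ∀ {x y} → x ≺ y → ¬ y ≺ x
  ≺-asym = Fin.<-asym

  ≺-flip : ∀ {x y} → ¬ x ≈ y → ¬ x ≺ y → y ≺ x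
  ≺-flip {x} {y} x≉y x⊀y with Fin.<-cmp (to x) (to y)
  ... | tri< x≺y _ _ = ⊥-elim (x⊀y x≺y)
  ... | tri≈ _ e _   = ⊥-elim (x≉y (injective e))
  ... | tri> _ _ y≺x = y≺x

  ∣∣-involution : (P? : Decidable P) → P Respects _≈_ → (f : Carrier → Carrier) → Congruent _≈_ _≈_ f →
                  (∀ {x} → P x → P (f x)) → (∀ {x} → P x → f (f x) ≈ x) → (∀ {x} → P x → ¬ f x ≈ x) →
                  let H? = P? ∩? (λ x → x ≺? f x) in ∣ P? ∣ ≡ ∣ H? ∣ + ∣ H? ∣
  ∣∣-involution {P = P} P? resp f f-cong closed involutive fixed-point-free =
    ≡.trans (count-involution (P? ∘ from) f̂ closed̂ involutivê fixed-point-freê) (≡.cong₂ _+_ halves halves)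
    where
      f̂ : Fin n → Fin n
      f̂ = to ∘ f ∘ from
      closed̂ : ∀ {i} → P (from i) → P (from (f̂ i))
      closed̂ p = resp (sym (strictlyInverseʳ _)) (closed p)
      involutivê : ∀ {i} → P (from i) → f̂ (f̂ i) ≡ i
      involutivê {i} p = ≡.trans (to-cong (trans (f-cong (strictlyInverseʳ _)) (involutive p))) (strictlyInverseˡ i)
      fixed-point-freê : ∀ {i} → P (from i) → f̂ i ≢ i
      fixed-point-freê p e = fixed-point-free p (sym (from-to (≡.sym e)))
      halves : count ((P? ∘ from) ∩? (λ i → i <? f̂ i)) ≡ ∣ P? ∩? (λ x → x ≺? f x) ∣
      halves = count-cong ((P? ∘ from) ∩? (λ i → i <? f̂ i)) ((P? ∩? (λ x → x ≺? f x)) ∘ from)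
                 (map₂ (≡.subst (_< f̂ _) (≡.sym (strictlyInverseˡ _))))
                 (map₂ (≡.subst (_< f̂ _) (strictlyInverseˡ _)))

module SetoidPredicates {a ℓ} (S : Setoid a ℓ) where

  open Setoid S

  private
    variable
      p : Level
      P Q : Pred Carrier p

  ∩-resp : P Respects _≈_ → Q Respects _≈_ → (P ∩ Q) Respects _≈_
  ∩-resp P-resp Q-resp x≈y (px , qx) = P-resp x≈y px , Q-resp x≈y qx

  ∁-resp : P Respects _≈_ → ∁ P Respects _≈_
  ∁-resp P-resp x≈y ¬px py = ¬px (P-resp (sym x≈y) py)

  ≈-resp : ∀ {z} → (_≈ z) Respects _≈_
  ≈-resp x≈y x≈z = trans (sym x≈y) x≈z

module IntegerCoefficients {c ℓ} (R : CommutativeRing c ℓ) where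

  open import Algebra.Solver.Ring.AlmostCommutativeRing using (_-Raw-AlmostCommutative⟶_; fromCommutativeRing)
  open import Data.Integer.Base as ℤ using (ℤ; +_; -[1+_]; _⊖_; _◃_)
  import Data.Integer.Properties as ℤ
  open import Data.Maybe.Base using (Maybe; just; nothing)
  open import Data.Nat.Base as ℕ using (zero; suc)
  import Data.Nat.Properties as ℕ
  open import Data.Sign.Base as Sign using ()

  open CommutativeRing R
  open import Algebra.Properties.Semiring.Mult.TCOptimised semiring using (×-homo-+; ×1-homo-*) renaming (_×_ to _·_)
  open import Algebra.Properties.Ring ring using (-‿distribˡ-*; -‿distribʳ-*; -‿involutive; -0#≈0#; -‿+-comm)
  open import Algebra.Properties.CommutativeSemigroup +-commutativeSemigroup using (interchange)
  open import Relation.Binary.Reasoning.Setoid setoid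

  fromℤ : ℤ → Carrier
  fromℤ (+ n)    = n · 1#
  fromℤ -[1+ n ] = - (suc n · 1#)

  private
    fromℤ-⊖ : ∀ m n → fromℤ (m ⊖ n) ≈ m · 1# - n · 1#
    fromℤ-⊖ m       zero    = sym (trans (+-congˡ -0#≈0#) (+-identityʳ _))
    fromℤ-⊖ zero    (suc n) = sym (+-identityˡ _)
    fromℤ-⊖ (suc m) (suc n) = begin
      fromℤ (suc m ⊖ suc n)                    ≡⟨ ≡.cong fromℤ (ℤ.[1+m]⊖[1+n]≡m⊖n m n) ⟩
      fromℤ (m ⊖ n)                            ≈⟨ fromℤ-⊖ m n ⟩
      m · 1# - n · 1#                          ≈⟨ +-identityˡ _ ⟨
      0# + (m · 1# - n · 1#)                   ≈⟨ +-congʳ (-‿inverseʳ 1#) ⟨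
      (1# - 1#) + (m · 1# - n · 1#)            ≈⟨ interchange 1# (- 1#) (m · 1#) (- (n · 1#)) ⟩
      (1# + m · 1#) + (- 1# - n · 1#)          ≈⟨ +-congˡ (-‿+-comm 1# (n · 1#)) ⟩
      (1# + m · 1#) - (1# + n · 1#)            ≈⟨ +-cong (sym (×-homo-+ 1# 1 m)) (-‿cong (sym (×-homo-+ 1# 1 n))) ⟩
      suc m · 1# - suc n · 1#                  ∎

    fromℤ-+ : ∀ i j → fromℤ (i ℤ.+ j) ≈ fromℤ i + fromℤ j
    fromℤ-+ -[1+ m ] -[1+ n ] = begin
      - (suc (suc (m ℕ.+ n)) · 1#)       ≡⟨ ≡.cong (λ k → - (suc k · 1#)) (ℕ.+-suc m n) ⟨
      - ((suc m ℕ.+ suc n) · 1#)         ≈⟨ -‿cong (×-homo-+ 1# (suc m) (suc n)) ⟩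
      - (suc m · 1# + suc n · 1#)        ≈⟨ -‿+-comm _ _ ⟨
      - (suc m · 1#) + - (suc n · 1#)    ∎
    fromℤ-+ -[1+ m ] (+ n)    = trans (fromℤ-⊖ n (suc m)) (+-comm _ _)
    fromℤ-+ (+ m)    -[1+ n ] = fromℤ-⊖ m (suc n)
    fromℤ-+ (+ m)    (+ n)    = ×-homo-+ 1# m n

    fromℤ-◃⁺ : ∀ n → fromℤ (Sign.+ ◃ n) ≈ n · 1#
    fromℤ-◃⁺ zero    = refl
    fromℤ-◃⁺ (suc n) = refl

    fromℤ-◃⁻ : ∀ n → fromℤ (Sign.- ◃ n) ≈ - (n · 1#)
    fromℤ-◃⁻ zero    = sym -0#≈0#
    fromℤ-◃⁻ (suc n) = refl

    fromℤ-* : ∀ i j → fromℤ (i ℤ.* j) ≈ fromℤ i * fromℤ j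
    fromℤ-* (+ m)    (+ n)    = trans (fromℤ-◃⁺ (m ℕ.* n)) (×1-homo-* m n)
    fromℤ-* (+ m)    -[1+ n ] = begin
      fromℤ (Sign.- ◃ (m ℕ.* suc n))  ≈⟨ fromℤ-◃⁻ (m ℕ.* suc n) ⟩
      - ((m ℕ.* suc n) · 1#)          ≈⟨ -‿cong (×1-homo-* m (suc n)) ⟩
      - (m · 1# * suc n · 1#)         ≈⟨ -‿distribʳ-* _ _ ⟩
      m · 1# * - (suc n · 1#)         ∎
    fromℤ-* -[1+ m ] (+ n)    = begin
      fromℤ (Sign.- ◃ (suc m ℕ.* n))  ≈⟨ fromℤ-◃⁻ (suc m ℕ.* n) ⟩
      - ((suc m ℕ.* n) · 1#)          ≈⟨ -‿cong (×1-homo-* (suc m) n) ⟩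
      - (suc m · 1# * n · 1#)         ≈⟨ -‿distribˡ-* _ _ ⟩
      - (suc m · 1#) * n · 1#         ∎
    fromℤ-* -[1+ m ] -[1+ n ] = begin
      fromℤ (Sign.+ ◃ (suc m ℕ.* suc n))  ≈⟨ fromℤ-◃⁺ (suc m ℕ.* suc n) ⟩
      (suc m ℕ.* suc n) · 1#              ≈⟨ ×1-homo-* (suc m) (suc n) ⟩
      suc m · 1# * suc n · 1#             ≈⟨ -‿involutive _ ⟨
      - - (suc m · 1# * suc n · 1#)       ≈⟨ -‿cong (-‿distribʳ-* _ _) ⟩
      - (suc m · 1# * - (suc n · 1#))     ≈⟨ -‿distribˡ-* _ _ ⟩
      - (suc m · 1#) * - (suc n · 1#)     ∎

    fromℤ-neg : ∀ i → fromℤ (ℤ.- i) ≈ - fromℤ i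
    fromℤ-neg -[1+ n ]  = sym (-‿involutive _)
    fromℤ-neg (+ zero)  = sym -0#≈0#
    fromℤ-neg (+ suc n) = refl

    homomorphism : ℤ.+-*-rawRing -Raw-AlmostCommutative⟶ fromCommutativeRing R
    homomorphism = record
      { ⟦_⟧    = fromℤ
      ; +-homo = fromℤ-+
      ; *-homo = fromℤ-*
      ; -‿homo = fromℤ-neg
      ; 0-homo = refl
      ; 1-homo = refl
      }

    fromℤ-≟ : ∀ i j → Maybe (fromℤ i ≈ fromℤ j)
    fromℤ-≟ i j with i ℤ.≟ j
    ... | yes ≡.refl = just refl
    ... | no _       = nothing

  open import Algebra.Solver.Ring ℤ.+-*-rawRing (fromCommutativeRing R) homomorphism fromℤ-≟ public

  infixl 10 _:²

  _:² : ∀ {n} → Polynomial n → Polynomial n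
  p :² = p :* p

  𝟙 𝟚 𝟜 : ∀ {n} → Polynomial n
  𝟙 = con (+ 1)
  𝟚 = 𝟙 :+ 𝟙
  𝟜 = 𝟚 :+ 𝟚

module Field {c ℓ} (F : CommutativeRing c ℓ) (isField : IsField F) where

  open CommutativeRing F
  open SetoidPredicates setoid
  open IntegerCoefficients F
  open import Algebra.Properties.Ring ring using (-‿involutive; -0#≈0#)
  open import Relation.Binary.Reasoning.Setoid setoid

  IsSquare : Pred Carrier (c ⊔ ℓ)
  IsSquare x = ∃ λ y → x ≈ sq F y

  IsSquare-resp : IsSquare Respects _≈_
  IsSquare-resp x≈y (z , x≈z²) = z , trans (sym x≈y) x≈z²

  NonZero : Pred Carrier ℓ
  NonZero x = x ≉ 0#

  NonZero-resp : NonZero Respects _≈_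
  NonZero-resp x≈y x≉0 y≈0 = x≉0 (trans x≈y y≈0)

  NonZeroSquare NonSquare : Pred Carrier (c ⊔ ℓ)
  NonZeroSquare = NonZero ∩ IsSquare
  NonSquare     = NonZero ∩ ∁ IsSquare

  NonZeroSquare-resp : NonZeroSquare Respects _≈_
  NonZeroSquare-resp = ∩-resp NonZero-resp IsSquare-resp

  NonSquare-resp : NonSquare Respects _≈_
  NonSquare-resp = ∩-resp NonZero-resp (∁-resp IsSquare-resp)

  1≉0 : 1# ≉ 0#
  1≉0 = proj₁ isField

  inverse : ∀ {x} → x ≉ 0# → ∃ λ y → x * y ≈ 1#
  inverse = proj₂ isField _

  sq≈1 : ∀ {x} → x ≈ 1# → sq F x ≈ 1#
  sq≈1 x≈1 = trans (*-cong x≈1 x≈1) (*-identityʳ 1#)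

  *-cancelˡ : ∀ {a x y} → a ≉ 0# → a * x ≈ a * y → x ≈ y
  *-cancelˡ {a} {x} {y} a≉0 ax≈ay = begin
    x              ≈⟨ z≈a⁻¹[az] x ⟩
    a⁻¹ * (a * x)  ≈⟨ *-congˡ ax≈ay ⟩
    a⁻¹ * (a * y)  ≈⟨ z≈a⁻¹[az] y ⟨
    y              ∎
    where
      a⁻¹ : Carrier
      a⁻¹ = proj₁ (inverse a≉0)
      z≈a⁻¹[az] : ∀ z → z ≈ a⁻¹ * (a * z)
      z≈a⁻¹[az] z = begin
        z                ≈⟨ *-identityˡ z ⟨
        1# * z           ≈⟨ *-congʳ (proj₂ (inverse a≉0)) ⟨
        (a * a⁻¹) * z    ≈⟨ solve 3 (λ a b z → a :* b :* z := b :* (a :* z)) refl a a⁻¹ z ⟩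
        a⁻¹ * (a * z)    ∎

  *-≉0 : ∀ {x y} → x ≉ 0# → y ≉ 0# → x * y ≉ 0#
  *-≉0 {x} {y} x≉0 y≉0 xy≈0 = y≉0 (*-cancelˡ x≉0 (trans xy≈0 (sym (zeroʳ x))))

  NonZeroSquare-* : ∀ {x y} → NonZeroSquare x → NonZeroSquare y → NonZeroSquare (x * y)
  NonZeroSquare-* {x} {y} (x≉0 , (a , x≈a²)) (y≉0 , (b , y≈b²)) = *-≉0 x≉0 y≉0 , (a * b , (begin
    x * y                ≈⟨ *-cong x≈a² y≈b² ⟩
    sq F a * sq F b      ≈⟨ solve 2 (λ a b → a :² :* b :² := (a :* b) :²) refl a b ⟩
    sq F (a * b)         ∎))

  -‿≉0 : ∀ {x} → x ≉ 0# → - x ≉ 0#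
  -‿≉0 {x} x≉0 -x≈0 = x≉0 (trans (sym (-‿involutive x)) (trans (-‿cong -x≈0) -0#≈0#))

  square-≉0 : ∀ {x y} → y ≉ 0# → x ≈ sq F y → x ≉ 0#
  square-≉0 y≉0 x≈y² x≈0 = *-≉0 y≉0 y≉0 (trans (sym x≈y²) x≈0)

  square-root-≉0 : ∀ {x y} → x ≉ 0# → x ≈ sq F y → y ≉ 0#
  square-root-≉0 {y = y} x≉0 x≈y² y≈0 = x≉0 (trans x≈y² (trans (*-congʳ y≈0) (zeroˡ y)))

  fourthPower-of-square : ∀ {x y} → x ≈ sq F y → IsSquare y → IsFourthPower F x
  fourthPower-of-square x≈y² (w , y≈w²) = w , trans x≈y² (*-cong y≈w² y≈w²)

  -‿square : ∀ {ζ x y} → sq F ζ ≈ - 1# → x ≈ sq F y → - x ≈ sq F (ζ * y)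
  -‿square {ζ} {x} {y} ζ²≈-1 x≈y² = begin
    - x                 ≈⟨ -‿cong x≈y² ⟩
    - sq F y            ≈⟨ solve 1 (λ y → :- y :² := :- 𝟙 :* y :²) refl y ⟩
    - 1# * sq F y       ≈⟨ *-congʳ ζ²≈-1 ⟨
    sq F ζ * sq F y     ≈⟨ solve 2 (λ ζ y → ζ :² :* y :² := (ζ :* y) :²) refl ζ y ⟩
    sq F (ζ * y)        ∎

  square-of-quotient : ∀ {d x y} → d ≉ 0# → x * sq F d ≈ sq F y → IsSquare x
  square-of-quotient {d} {x} {y} d≉0 xd²≈y² = y * d⁻¹ , *-cancelˡ (*-≉0 d≉0 d≉0) (begin
    sq F d * x               ≈⟨ *-comm _ _ ⟩
    x * sq F d               ≈⟨ xd²≈y² ⟩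
    sq F y                   ≈⟨ *-identityʳ _ ⟨
    sq F y * 1#              ≈⟨ *-congˡ (sq≈1 dd⁻¹≈1) ⟨
    sq F y * sq F (d * d⁻¹)  ≈⟨ solve 3 (λ y d e → y :² :* (d :* e) :² := d :² :* (y :* e) :²) refl y d d⁻¹ ⟩
    sq F d * sq F (y * d⁻¹)  ∎)
    where
      d⁻¹ : Carrier
      d⁻¹ = proj₁ (inverse d≉0)
      dd⁻¹≈1 : d * d⁻¹ ≈ 1#
      dd⁻¹≈1 = proj₂ (inverse d≉0)

  square-class-transfer : ∀ {z a b d t} → a ≉ 0# → d ≉ 0# → IsSquare (z * a) → a * b * sq F d ≈ sq F t →
                          IsSquare (z * b)
  square-class-transfer {z} {a} {b} {d} {t} a≉0 d≉0 (w , za≈w²) abd²≈t² =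
    square-of-quotient (*-≉0 a≉0 d≉0) (begin
      z * b * sq F (a * d)      ≈⟨ solve 4 (λ z a b d → z :* b :* (a :* d) :² := z :* a :* (a :* b :* d :²)) refl z a b d ⟩
      z * a * (a * b * sq F d)  ≈⟨ *-cong za≈w² abd²≈t² ⟩
      sq F w * sq F t           ≈⟨ solve 2 (λ w t → w :² :* t :² := (w :* t) :²) refl w t ⟩
      sq F (w * t)              ∎)

module Advancement {c ℓ} (F : CommutativeRing c ℓ) (isField : IsField F) (two≉0 : CharNot2 F) where

  open import Data.Nat.Base using (zero; suc)
  open CommutativeRing F
  open Field F isField
  open IntegerCoefficients F
  open import Algebra.Properties.Ring ring using (-‿involutive; x∙y⁻¹≈ε⇒x≈y; +-inverseˡ-unique)
  open import Relation.Binary.Reasoning.Setoid setoid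

  four≉0 : four F ≉ 0#
  four≉0 4≈0 = *-≉0 two≉0 two≉0 (trans (solve 0 (𝟚 :* 𝟚 := 𝟜) refl) 4≈0)

  1+k≉0 : ∀ {k} → T F k → 1# + k ≉ 0#
  1+k≉0 {k} (_ , _ , k≉-1) 1+k≈0 = k≉-1 (+-inverseˡ-unique k 1# (trans (+-comm k 1#) 1+k≈0))

  T-neg : ∀ {k} → T F k → T F (- k)
  T-neg {k} (k≉0 , k≉1 , k≉-1) =
    -‿≉0 k≉0 ,
    (λ -k≈1 → k≉-1 (trans (sym (-‿involutive k)) (-‿cong -k≈1))) ,
    (λ -k≈-1 → k≉1 (trans (sym (-‿involutive k)) (trans (-‿cong -k≈-1) (-‿involutive 1#))))

  successor-T : ∀ {k k′} → T F k → sq F (1# + k) * sq F k′ ≈ four F * k → T F k′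
  successor-T {k} {k′} (k≉0 , k≉1 , _) e =
    k′≉0 , (λ k′≈1 → k′²≉1 (sq≈1 k′≈1)) , (λ k′≈-1 → k′²≉1 (trans (*-cong k′≈-1 k′≈-1) (-1²≈1)))
    where
      -1²≈1 : - 1# * - 1# ≈ 1#
      -1²≈1 = solve 0 ((:- 𝟙) :² := 𝟙) refl
      k′≉0 : k′ ≉ 0#
      k′≉0 k′≈0 = *-≉0 four≉0 k≉0 (begin
        four F * k                 ≈⟨ e ⟨
        sq F (1# + k) * sq F k′    ≈⟨ *-congˡ (*-congʳ k′≈0) ⟩
        sq F (1# + k) * (0# * k′)  ≈⟨ *-congˡ (zeroˡ k′) ⟩
        sq F (1# + k) * 0#         ≈⟨ zeroʳ _ ⟩
        0#                         ∎)
      k′²≉1 : sq F k′ ≉ 1#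
      k′²≉1 k′²≈1 = *-≉0 1-k≉0 1-k≉0 (begin
        sq F (1# - k)                    ≈⟨ solve 1 (λ k → (𝟙 :- k) :² := (𝟙 :+ k) :² :* 𝟙 :- 𝟜 :* k) refl k ⟩
        sq F (1# + k) * 1# - four F * k  ≈⟨ +-congʳ (trans (*-congˡ (sym k′²≈1)) e) ⟩
        four F * k - four F * k          ≈⟨ -‿inverseʳ _ ⟩
        0#                               ∎)
        where
          1-k≉0 : 1# - k ≉ 0#
          1-k≉0 1-k≈0 = k≉1 (sym (x∙y⁻¹≈ε⇒x≈y 1# k 1-k≈0))

  Δ : Carrier → Carrier
  Δ k = four F * k * sq F (1# + k)

  HasSquareSuccessor : Pred Carrier (c ⊔ ℓ)
  HasSquareSuccessor k = ∃ λ k₁ → _↦_ F k k₁ × IsSquare k₁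

  predecessor-square : ∀ {k₁ k₂} → _↦_ F k₁ k₂ → IsSquare k₁
  predecessor-square {k₁} {k₂} (_ , _ , e) = square-of-quotient two≉0 (begin
    k₁ * sq F (two F)          ≈⟨ solve 1 (λ k → k :* 𝟚 :² := 𝟜 :* k) refl k₁ ⟩
    four F * k₁                ≈⟨ e ⟨
    sq F (1# + k₁) * sq F k₂   ≈⟨ solve 2 (λ a b → a :² :* b :² := (a :* b) :²) refl (1# + k₁) k₂ ⟩
    sq F ((1# + k₁) * k₂)      ∎)

  Δ-fourthPower : ∀ {k k₁} → _↦_ F k k₁ → IsSquare k₁ → IsFourthPower F (Δ k)
  Δ-fourthPower {k} {k₁} (_ , _ , e) (w , k₁≈w²) = (1# + k) * w , (begin
    four F * k * sq F (1# + k)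
      ≈⟨ *-congʳ e ⟨
    sq F (1# + k) * sq F k₁ * sq F (1# + k)
      ≈⟨ *-congʳ (*-congˡ (*-cong k₁≈w² k₁≈w²)) ⟩
    sq F (1# + k) * sq F (sq F w) * sq F (1# + k)
      ≈⟨ solve 2 (λ p w → p :² :* w :² :² :* p :² := (p :* w) :² :²) refl (1# + k) w ⟩
    sq F (sq F ((1# + k) * w))
      ∎)

  Δ-fourthPower⇒squareSuccessor : ∀ {k} → T F k → IsFourthPower F (Δ k) → HasSquareSuccessor k
  Δ-fourthPower⇒squareSuccessor {k} Tk (y , Δ≈y⁴) =
    sq F (y * u) , (Tk , successor-T Tk k↦k₁ , k↦k₁) , (y * u , refl)
    where
      p u : Carrier
      p = 1# + k
      u = proj₁ (inverse (1+k≉0 Tk))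
      k↦k₁ : sq F p * sq F (sq F (y * u)) ≈ four F * k
      k↦k₁ = begin
        sq F p * sq F (sq F (y * u))
          ≈⟨ solve 3 (λ p y u → p :² :* (y :* u) :² :² := y :² :² :* p :² :* u :² :²) refl p y u ⟩
        sq F (sq F y) * sq F p * sq F (sq F u)
          ≈⟨ *-congʳ (*-congʳ Δ≈y⁴) ⟨
        four F * k * sq F p * sq F p * sq F (sq F u)
          ≈⟨ solve 3 (λ a p u → a :* p :² :* p :² :* u :² :² := a :* (p :* u) :² :²) refl (four F * k) p u ⟩
        four F * k * sq F (sq F (p * u))
          ≈⟨ *-congˡ (sq≈1 (sq≈1 (proj₂ (inverse (1+k≉0 Tk))))) ⟩
        four F * k * 1#
          ≈⟨ *-identityʳ _ ⟩
        four F * k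
          ∎

  Δ-of-square : ∀ {k s} → k ≈ sq F s → Δ k ≈ sq F (two F * s * (1# + k))
  Δ-of-square {k} {s} k≈s² = begin
    four F * k * sq F (1# + k)
      ≈⟨ *-congʳ (*-congˡ k≈s²) ⟩
    four F * sq F s * sq F (1# + k)
      ≈⟨ solve 2 (λ s k → 𝟜 :* s :² :* (𝟙 :+ k) :² := (𝟚 :* s :* (𝟙 :+ k)) :²) refl s k ⟩
    sq F (two F * s * (1# + k))
      ∎

  Δ-of-neg-square : ∀ {ζ k s} → sq F ζ ≈ - 1# → k ≈ sq F s → Δ (- k) ≈ sq F (ζ * (two F * s * (1# - k)))
  Δ-of-neg-square {ζ} {k} {s} ζ²≈-1 k≈s² = begin
    four F * - k * sq F (1# - k)
      ≈⟨ *-congʳ (*-congˡ (-‿cong k≈s²)) ⟩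
    four F * - sq F s * sq F (1# - k)
      ≈⟨ solve 2 (λ s k → 𝟜 :* :- s :² :* (𝟙 :- k) :² := :- (𝟚 :* s :* (𝟙 :- k)) :²) refl s k ⟩
    - sq F (two F * s * (1# - k))
      ≈⟨ -‿square ζ²≈-1 refl ⟩
    sq F (ζ * (two F * s * (1# - k)))
      ∎

  successor-product : ∀ {k k₁} s → sq F (1# + k) * sq F k₁ ≈ four F * k →
                      two F * s * (1# + k₁) * (two F * s * (1# - k₁)) * sq F (1# + k) ≈ sq F (two F * s * (1# - k))
  successor-product {k} {k₁} s e = begin
    two F * s * (1# + k₁) * (two F * s * (1# - k₁)) * sq F p
      ≈⟨ solve 3 (λ s k₁ p → 𝟚 :* s :* (𝟙 :+ k₁) :* (𝟚 :* s :* (𝟙 :- k₁)) :* p :²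
                           := 𝟜 :* s :² :* (p :² :- p :² :* k₁ :²)) refl s k₁ p ⟩
    four F * sq F s * (sq F p - sq F p * sq F k₁)
      ≈⟨ *-congˡ (+-congˡ (-‿cong e)) ⟩
    four F * sq F s * (sq F p - four F * k)
      ≈⟨ solve 2 (λ s k → 𝟜 :* s :² :* ((𝟙 :+ k) :² :- 𝟜 :* k) := (𝟚 :* s :* (𝟙 :- k)) :²) refl s k ⟩
    sq F (two F * s * (1# - k))
      ∎
    where
      p : Carrier
      p = 1# + k

  module _ (ζ : Carrier) (ζ²≈-1 : sq F ζ ≈ - 1#)
           (square-classes : ∀ {x} → x ≉ 0# → IsSquare x ⊎ IsSquare (ζ * x)) where

    squareSuccessor-extends : ∀ {k} → HasSquareSuccessor k → ∃ λ k′ → _↦_ F k k′ × HasSquareSuccessor k′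
    squareSuccessor-extends {k} (k₁ , k↦k₁@(Tk , Tk₁ , e) , (s , k₁≈s²)) = extend (square-classes A≉0)
      where
        A B : Carrier
        A = two F * s * (1# + k₁)
        B = two F * s * (1# - k₁)
        A≉0 : A ≉ 0#
        A≉0 = *-≉0 (*-≉0 two≉0 (square-root-≉0 (proj₁ Tk₁) k₁≈s²)) (1+k≉0 Tk₁)
        extend : IsSquare A ⊎ IsSquare (ζ * A) → ∃ λ k′ → _↦_ F k k′ × HasSquareSuccessor k′
        extend (inj₁ A-square)  =
          k₁ , k↦k₁ , Δ-fourthPower⇒squareSuccessor Tk₁ (fourthPower-of-square (Δ-of-square k₁≈s²) A-square)
        extend (inj₂ ζA-square) = - k₁ , k↦-k₁ , Δ-fourthPower⇒squareSuccessor (T-neg Tk₁) Δ[-k₁]-fourthPower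
          where
            k↦-k₁ : _↦_ F k (- k₁)
            k↦-k₁ = Tk , T-neg Tk₁ , trans (*-congˡ (solve 1 (λ x → (:- x) :² := x :²) refl k₁)) e
            ζB-square : IsSquare (ζ * B)
            ζB-square = square-class-transfer A≉0 (1+k≉0 Tk) ζA-square (successor-product s e)
            Δ[-k₁]-fourthPower : IsFourthPower F (Δ (- k₁))
            Δ[-k₁]-fourthPower = fourthPower-of-square (Δ-of-neg-square ζ²≈-1 k₁≈s²) ζB-square

    squareSuccessor⇒Adv : ∀ n {k} → HasSquareSuccessor k → Adv F n k
    squareSuccessor⇒Adv zero    (_ , (Tk , _) , _) = lift Tk
    squareSuccessor⇒Adv (suc n) h = map₂ (map₂ (squareSuccessor⇒Adv n)) (squareSuccessor-extends h)

  Adv₂⇒Δ-fourthPower : ∀ {k} → Adv F 2 k → T F k × IsFourthPower F (Δ k)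
  Adv₂⇒Δ-fourthPower (_ , k↦k₁@(Tk , _) , (_ , k₁↦k₂ , _)) = Tk , Δ-fourthPower k↦k₁ (predecessor-square k₁↦k₂)

module DiscreteField {c ℓ} (F : CommutativeRing c ℓ) (isField : IsField F)
                     (_≟_ : Decidable₂ (CommutativeRing._≈_ F)) where

  open CommutativeRing F
  open Field F isField
  open IntegerCoefficients F
  open import Algebra.Properties.Ring ring using (x∙y⁻¹≈ε⇒x≈y; x≈y⇒x∙y⁻¹≈ε; +-inverseˡ-unique)
  open import Relation.Binary.Reasoning.Setoid setoid

  zero-product : ∀ {x y} → x * y ≈ 0# → x ≈ 0# ⊎ y ≈ 0#
  zero-product {x} {y} xy≈0 with x ≟ 0# | y ≟ 0#
  ... | yes x≈0 | _       = inj₁ x≈0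
  ... | no _    | yes y≈0 = inj₂ y≈0
  ... | no x≉0  | no y≉0  = ⊥-elim (*-≉0 x≉0 y≉0 xy≈0)

  square-roots : ∀ {x y} → sq F x ≈ sq F y → x ≈ y ⊎ x ≈ - y
  square-roots {x} {y} x²≈y² with zero-product (begin
      (x - y) * (x + y)     ≈⟨ solve 2 (λ x y → (x :- y) :* (x :+ y) := x :² :- y :²) refl x y ⟩
      sq F x - sq F y       ≈⟨ x≈y⇒x∙y⁻¹≈ε x²≈y² ⟩
      0#                    ∎)
  ... | inj₁ x-y≈0 = inj₁ (x∙y⁻¹≈ε⇒x≈y x y x-y≈0)
  ... | inj₂ x+y≈0 = inj₂ (+-inverseˡ-unique x y x+y≈0)

  _⁻¹ : Carrier → Carrier
  x ⁻¹ with x ≟ 0#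
  ... | yes _   = 0#
  ... | no x≉0  = proj₁ (inverse x≉0)

  ⁻¹-inverse : ∀ {x} → x ≉ 0# → x * x ⁻¹ ≈ 1#
  ⁻¹-inverse {x} x≉0 with x ≟ 0#
  ... | yes x≈0 = ⊥-elim (x≉0 x≈0)
  ... | no x≉0′ = proj₂ (inverse x≉0′)

  ⁻¹-unique : ∀ {x y} → x * y ≈ 1# → y ≈ x ⁻¹
  ⁻¹-unique {x} {y} xy≈1 = *-cancelˡ x≉0 (trans xy≈1 (sym (⁻¹-inverse x≉0)))
    where
      x≉0 : x ≉ 0#
      x≉0 x≈0 = 1≉0 (trans (sym xy≈1) (trans (*-congʳ x≈0) (zeroˡ y)))

  ⁻¹-≉0 : ∀ {x} → x ≉ 0# → x ⁻¹ ≉ 0#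
  ⁻¹-≉0 {x} x≉0 x⁻¹≈0 = 1≉0 (trans (sym (⁻¹-inverse x≉0)) (trans (*-congˡ x⁻¹≈0) (zeroʳ x)))

  ⁻¹-involutive : ∀ {x} → x ≉ 0# → x ⁻¹ ⁻¹ ≈ x
  ⁻¹-involutive x≉0 = sym (⁻¹-unique (trans (*-comm _ _) (⁻¹-inverse x≉0)))

  ⁻¹-zero : ∀ {x} → x ≈ 0# → x ⁻¹ ≈ 0#
  ⁻¹-zero {x} x≈0 with x ≟ 0#
  ... | yes _   = refl
  ... | no x≉0  = ⊥-elim (x≉0 x≈0)

  ⁻¹-cong : ∀ {x y} → x ≈ y → x ⁻¹ ≈ y ⁻¹
  ⁻¹-cong {x} {y} x≈y = by-cases (x ≟ 0#)
    where
      by-cases : Dec (x ≈ 0#) → x ⁻¹ ≈ y ⁻¹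
      by-cases (yes x≈0) = trans (⁻¹-zero x≈0) (sym (⁻¹-zero (trans (sym x≈y) x≈0)))
      by-cases (no x≉0)  = ⁻¹-unique (trans (*-congʳ (sym x≈y)) (⁻¹-inverse x≉0))

  ⁻¹-square : ∀ {x} → x ≉ 0# → IsSquare x → IsSquare (x ⁻¹)
  ⁻¹-square {x} x≉0 (y , x≈y²) = y ⁻¹ , sym (⁻¹-unique (begin
    x * sq F (y ⁻¹)               ≈⟨ *-congʳ x≈y² ⟩
    sq F y * sq F (y ⁻¹)          ≈⟨ solve 2 (λ y z → y :² :* z :² := (y :* z) :²) refl y (y ⁻¹) ⟩
    sq F (y * y ⁻¹)               ≈⟨ sq≈1 (⁻¹-inverse y≉0) ⟩
    1#                            ∎))
    where
      y≉0 : y ≉ 0#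
      y≉0 = square-root-≉0 x≉0 x≈y²

module Arithmetic where

  open import Data.Nat.Base using (suc; _+_; _*_)
  open import Data.Nat.DivMod using ([m+kn]%n≡m%n)
  open import Data.Nat.Tactic.RingSolver using (solve-∀)
  open import Relation.Binary.PropositionalEquality using (trans; cong)

  [m+m]%2≡0 : ∀ m → (m + m) % 2 ≡ 0
  [m+m]%2≡0 m = trans (cong (_% 2) (normal-form m)) ([m+kn]%n≡m%n 0 m 2)
    where
      normal-form : ∀ m → m + m ≡ 0 + m * 2
      normal-form = solve-∀

  [1+2[1+2m]]%4≡3 : ∀ m → suc (suc (m + m) + suc (m + m)) % 4 ≡ 3
  [1+2[1+2m]]%4≡3 m = trans (cong (_% 4) (normal-form m)) ([m+kn]%n≡m%n 3 m 4)
    where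
      normal-form : ∀ m → suc (suc (m + m) + suc (m + m)) ≡ 3 + m * 4
      normal-form = solve-∀

  [1+2[2[2m]]]%8≡1 : ∀ m → suc ((m + m + (m + m)) + (m + m + (m + m))) % 8 ≡ 1
  [1+2[2[2m]]]%8≡1 m = trans (cong (_% 8) (normal-form m)) ([m+kn]%n≡m%n 1 m 8)
    where
      normal-form : ∀ m → suc ((m + m + (m + m)) + (m + m + (m + m))) ≡ 1 + m * 8
      normal-form = solve-∀

module FiniteField {c ℓ} (F : CommutativeRing c ℓ) (isField : IsField F) {q} (card : HasCard F q) where

  open Arithmetic
  open import Data.Nat.Base as ℕ using (suc; _≤_; s≤s)
  open import Data.Nat.Properties using (≤-antisym; ≤-trans; ≤-reflexive; +-cancelˡ-≡; <-irrefl)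
  open CommutativeRing F
  open SetoidPredicates setoid
  open Field F isField
  open FiniteSetoid setoid card
  open DiscreteField F isField _≟_
  open IntegerCoefficients F
  open import Algebra.Properties.Ring ring using (-‿involutive; x≈y⇒x∙y⁻¹≈ε)
  open import Relation.Binary.Reasoning.Setoid setoid

  private
    variable
      p : Level
      P : Pred Carrier p

  NonZero? : Decidable NonZero
  NonZero? x = ¬? (x ≟ 0#)

  IsSquare? : Decidable IsSquare
  IsSquare? x = ∃? (λ y≈z x≈y² → trans x≈y² (*-cong y≈z y≈z)) (λ y → x ≟ sq F y)

  SquaresOf : Pred Carrier p → Pred Carrier (p ⊔ c ⊔ ℓ)
  SquaresOf P x = ∃ λ y → P y × x ≈ sq F y

  SquaresOf-resp : SquaresOf P Respects _≈_
  SquaresOf-resp x≈x′ (y , py , x≈y²) = y , py , trans (sym x≈x′) x≈y²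

  SquaresOf? : P Respects _≈_ → Decidable P → Decidable (SquaresOf P)
  SquaresOf? {P = P} P-resp P? x = ∃? resp (λ y → P? y ×-dec (x ≟ sq F y))
    where
      resp : (λ y → P y × x ≈ sq F y) Respects _≈_
      resp y≈z (py , x≈y²) = P-resp y≈z py , trans x≈y² (*-cong y≈z y≈z)

  odd-order⇒two≉0 : q % 2 ≡ 1 → two F ≉ 0#
  odd-order⇒two≉0 q%2≡1 2≈0 =
    0≢1 (≡.trans (≡.sym ([m+m]%2≡0 half)) (≡.trans (≡.cong (_% 2) (≡.sym q-even)) q%2≡1))
    where
      0≢1 : 0 ≡ 1 → ⊥
      0≢1 ()
      involutive : ∀ x → x + 1# + 1# ≈ x
      involutive x = begin
        x + 1# + 1#    ≈⟨ +-assoc x 1# 1# ⟩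
        x + two F      ≈⟨ +-congˡ 2≈0 ⟩
        x + 0#         ≈⟨ +-identityʳ x ⟩
        x              ∎
      fixed-point-free : ∀ x → x + 1# ≉ x
      fixed-point-free x x+1≈x = 1≉0 (begin
        1#              ≈⟨ solve 1 (λ x → 𝟙 := x :+ 𝟙 :- x) refl x ⟩
        x + 1# - x      ≈⟨ +-congʳ x+1≈x ⟩
        x - x           ≈⟨ -‿inverseʳ x ⟩
        0#              ∎)
      half : ℕ
      half = ∣ U? ∩? (λ x → x ≺? (x + 1#)) ∣
      q-even : q ≡ half ℕ.+ half
      q-even = ≡.trans (≡.sym (∣∣-universal U? (λ _ → tt)))
        (∣∣-involution U? (λ _ _ → tt) (_+ 1#) +-congʳ (λ _ → tt) (λ _ → involutive _) (λ _ → fixed-point-free _))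

  module _ (two≉0 : two F ≉ 0#) where

    -x≉x : ∀ {x} → x ≉ 0# → - x ≉ x
    -x≉x {x} x≉0 -x≈x = *-≉0 two≉0 x≉0 (begin
      two F * x     ≈⟨ solve 1 (λ x → 𝟚 :* x := x :- :- x) refl x ⟩
      x - - x       ≈⟨ x≈y⇒x∙y⁻¹≈ε (sym -x≈x) ⟩
      0#            ∎)

    -- Picks one element of each pair {x, −x} with x ≉ 0, using the enumeration order.
    Positive : Pred Carrier 0ℓ
    Positive x = x ≺ - x

    Positive? : Decidable Positive
    Positive? x = x ≺? - x

    Positive-resp : Positive Respects _≈_
    Positive-resp x≈y = ≺-resp x≈y (-‿cong x≈y)

    ¬Positive-neg : ∀ {x} → Positive x → ¬ Positive (- x)
    ¬Positive-neg x≺-x -x≺--x = ≺-asym x≺-x (≺-resp refl (-‿involutive _) -x≺--x)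

    Positive-±-unique : ∀ {x y} → Positive x → Positive y → x ≈ y ⊎ x ≈ - y → x ≈ y
    Positive-±-unique _          _          (inj₁ x≈y)  = x≈y
    Positive-±-unique x-positive y-positive (inj₂ x≈-y) =
      ⊥-elim (¬Positive-neg y-positive (Positive-resp x≈-y x-positive))

    abs : Carrier → Carrier
    abs x with Positive? x
    ... | yes _ = x
    ... | no _  = - x

    abs≈± : ∀ x → abs x ≈ x ⊎ abs x ≈ - x
    abs≈± x with Positive? x
    ... | yes _ = inj₁ refl
    ... | no _  = inj₂ refl

    abs-positive : ∀ {x} → x ≉ 0# → Positive (abs x)
    abs-positive {x} x≉0 with Positive? x
    ... | yes x≺-x = x≺-x
    ... | no x⊀-x  = ≺-resp refl (sym (-‿involutive x)) (≺-flip (-x≉x x≉0 ∘ sym) x⊀-x)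

    sq-abs : ∀ x → sq F (abs x) ≈ sq F x
    sq-abs x with abs≈± x
    ... | inj₁ e = *-cong e e
    ... | inj₂ e = trans (*-cong e e) (solve 1 (λ x → (:- x) :² := x :²) refl x)

    module _ {P : Pred Carrier p} (P? : Decidable P) (P-resp : P Respects _≈_)
             (P⇒≉0 : ∀ {x} → P x → x ≉ 0#) (P-neg : ∀ {x} → P x → P (- x)) where

      negation-halves : ∣ P? ∣ ≡ ∣ P? ∩? Positive? ∣ ℕ.+ ∣ P? ∩? Positive? ∣
      negation-halves = ∣∣-involution P? P-resp -_ -‿cong P-neg (λ _ → -‿involutive _) (-x≉x ∘ P⇒≉0)

      squaring-halves : let S? = SquaresOf? P-resp P? in ∣ P? ∣ ≡ ∣ S? ∣ ℕ.+ ∣ S? ∣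
      squaring-halves = ≡.trans negation-halves (≡.cong₂ ℕ._+_ positive≡squares positive≡squares)
        where
          S? : Decidable (SquaresOf P)
          S? = SquaresOf? P-resp P?

          root : Carrier → Carrier
          root x with S? x
          ... | yes (y , _) = y
          ... | no _        = 0#

          root-spec : ∀ {x} → SquaresOf P x → P (root x) × x ≈ sq F (root x)
          root-spec {x} sx with S? x
          ... | yes (_ , spec) = spec
          ... | no ¬sx         = ⊥-elim (¬sx sx)

          abs-root-spec : ∀ {x} → SquaresOf P x → (P ∩ Positive) (abs (root x)) × x ≈ sq F (abs (root x))
          abs-root-spec {x} sx with root-spec sx
          ... | p , x≈r² with abs≈± (root x)
          ...   | inj₁ e = (P-resp (sym e) p , abs-positive (P⇒≉0 p)) , trans x≈r² (sym (sq-abs _))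
          ...   | inj₂ e = (P-resp (sym e) (P-neg p) , abs-positive (P⇒≉0 p)) , trans x≈r² (sym (sq-abs _))

          squaring-injects : ∣ P? ∩? Positive? ∣ ≤ ∣ S? ∣
          squaring-injects = ∣∣-injection (P? ∩? Positive?) S? SquaresOf-resp (sq F) (λ {x} (px , _) → x , px , refl)
            (λ (_ , x-positive) (_ , y-positive) x²≈y² → Positive-±-unique x-positive y-positive (square-roots x²≈y²))

          abs-root-injects : ∣ S? ∣ ≤ ∣ P? ∩? Positive? ∣
          abs-root-injects = ∣∣-injection S? (P? ∩? Positive?) (∩-resp P-resp Positive-resp) (abs ∘ root)
            (proj₁ ∘ abs-root-spec)
            (λ sx sy e → trans (proj₂ (abs-root-spec sx)) (trans (*-cong e e) (sym (proj₂ (abs-root-spec sy)))))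

          positive≡squares : ∣ P? ∩? Positive? ∣ ≡ ∣ S? ∣
          positive≡squares = ≤-antisym squaring-injects abs-root-injects

    NonZeroSquare? : Decidable NonZeroSquare
    NonZeroSquare? = NonZero? ∩? IsSquare?

    NonSquare? : Decidable NonSquare
    NonSquare? = NonZero? ∩? ∁? IsSquare?

    order≡1+nonzero : q ≡ suc ∣ NonZero? ∣
    order≡1+nonzero = ≡.trans (≡.sym (∣∣-universal U? (λ _ → tt)))
      (≡.trans (∣∣-remove U? (λ _ _ → tt) tt) (≡.cong suc (∣∣-cong (U? ∩? ∁? (_≟ 0#)) NonZero? proj₂ (tt ,_))))

    nonzero≡2squares : ∣ NonZero? ∣ ≡ ∣ NonZeroSquare? ∣ ℕ.+ ∣ NonZeroSquare? ∣
    nonzero≡2squares = ≡.trans (squaring-halves NonZero? NonZero-resp id -‿≉0) (≡.cong₂ ℕ._+_ same same)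
      where
        same : ∣ SquaresOf? NonZero-resp NonZero? ∣ ≡ ∣ NonZeroSquare? ∣
        same = ∣∣-cong (SquaresOf? NonZero-resp NonZero?) NonZeroSquare?
                 (λ (y , y≉0 , x≈y²) → square-≉0 y≉0 x≈y² , (y , x≈y²))
                 (λ (x≉0 , (y , x≈y²)) → y , square-root-≉0 x≉0 x≈y² , x≈y²)

    order≡1+2squares : q ≡ suc (∣ NonZeroSquare? ∣ ℕ.+ ∣ NonZeroSquare? ∣)
    order≡1+2squares = ≡.trans order≡1+nonzero (≡.cong suc nonzero≡2squares)

    nonsquares≡squares : ∣ NonSquare? ∣ ≡ ∣ NonZeroSquare? ∣
    nonsquares≡squares = +-cancelˡ-≡ ∣ NonZeroSquare? ∣ _ _
      (≡.trans (≡.sym (∣∣-split NonZero? IsSquare?)) nonzero≡2squares)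

    nonsquare-mul : ∀ {a b} → NonSquare a → NonSquare b → IsSquare (a * b)
    nonsquare-mul {a} {b} (a≉0 , a-nonsquare) b-nonsquare with IsSquare? (a * b)
    ... | yes ab-square = ab-square
    ... | no ab-nonsquare =
      ⊥-elim (<-irrefl ≡.refl (≤-trans (s≤s injection) (≤-reflexive (≡.trans (≡.sym removal) nonsquares≡squares))))
      where
        others : Decidable (NonSquare ∩ ∁ (_≈ b))
        others = NonSquare? ∩? ∁? (_≟ b)
        removal : ∣ NonSquare? ∣ ≡ suc ∣ others ∣
        removal = ∣∣-remove NonSquare? NonSquare-resp b-nonsquare
        maps : ∀ {x} → NonZeroSquare x → (NonSquare ∩ ∁ (_≈ b)) (a * x)
        maps {x} (x≉0 , (y , x≈y²)) = (*-≉0 a≉0 x≉0 , ax-nonsquare) , ax≉b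
          where
            ax-nonsquare : ¬ IsSquare (a * x)
            ax-nonsquare (w , ax≈w²) =
              a-nonsquare (square-of-quotient (square-root-≉0 x≉0 x≈y²) (trans (*-congˡ (sym x≈y²)) ax≈w²))
            ax≉b : a * x ≉ b
            ax≉b ax≈b = ab-nonsquare (a * y , (begin
              a * b               ≈⟨ *-congˡ ax≈b ⟨
              a * (a * x)         ≈⟨ *-congˡ (*-congˡ x≈y²) ⟩
              a * (a * sq F y)    ≈⟨ solve 2 (λ a y → a :* (a :* y :²) := (a :* y) :²) refl a y ⟩
              sq F (a * y)        ∎))
        injection : ∣ NonZeroSquare? ∣ ≤ ∣ others ∣
        injection = ∣∣-injection NonZeroSquare? others (∩-resp NonSquare-resp (∁-resp ≈-resp)) (a *_) maps
                      (λ _ _ → *-cancelˡ a≉0)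

    -1-square : q % 4 ≡ 1 → IsSquare (- 1#)
    -1-square q%4≡1 with IsSquare? (- 1#)
    ... | yes -1-square = -1-square
    ... | no -1-nonsquare =
      ⊥-elim (3≢1 (≡.trans (≡.sym ([1+2[1+2m]]%4≡3 h)) (≡.trans (≡.cong (_% 4) (≡.sym q≡3+4h)) q%4≡1)))
      where
        3≢1 : 3 ≡ 1 → ⊥
        3≢1 ()
        others : Decidable (NonZeroSquare ∩ ∁ (_≈ 1#))
        others = NonZeroSquare? ∩? ∁? (_≟ 1#)
        closed : ∀ {x} → (NonZeroSquare ∩ ∁ (_≈ 1#)) x → (NonZeroSquare ∩ ∁ (_≈ 1#)) (x ⁻¹)
        closed {x} ((x≉0 , x-square) , x≉1) = (⁻¹-≉0 x≉0 , ⁻¹-square x≉0 x-square) , λ x⁻¹≈1 → x≉1 (begin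
          x            ≈⟨ ⁻¹-involutive x≉0 ⟨
          x ⁻¹ ⁻¹      ≈⟨ ⁻¹-cong x⁻¹≈1 ⟩
          1# ⁻¹        ≈⟨ ⁻¹-unique (*-identityʳ 1#) ⟨
          1#           ∎)
        fixed-point-free : ∀ {x} → (NonZeroSquare ∩ ∁ (_≈ 1#)) x → x ⁻¹ ≉ x
        fixed-point-free {x} ((x≉0 , x-square) , x≉1) x⁻¹≈x with square-roots {x} {1#} (begin
          sq F x         ≈⟨ *-congˡ x⁻¹≈x ⟨
          x * x ⁻¹       ≈⟨ ⁻¹-inverse x≉0 ⟩
          1#             ≈⟨ *-identityʳ 1# ⟨
          sq F 1#        ∎)
        ... | inj₁ x≈1  = x≉1 x≈1
        ... | inj₂ x≈-1 = -1-nonsquare (IsSquare-resp x≈-1 x-square)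
        h : ℕ
        h = ∣ others ∩? (λ x → x ≺? x ⁻¹) ∣
        squares-odd : ∣ NonZeroSquare? ∣ ≡ suc (h ℕ.+ h)
        squares-odd = ≡.trans (∣∣-remove NonZeroSquare? NonZeroSquare-resp (1≉0 , (1# , sym (*-identityʳ 1#))))
          (≡.cong suc (∣∣-involution others (∩-resp NonZeroSquare-resp (∁-resp ≈-resp)) _⁻¹ ⁻¹-cong closed
                         (⁻¹-involutive ∘ proj₁ ∘ proj₁) fixed-point-free))
        q≡3+4h : q ≡ suc (suc (h ℕ.+ h) ℕ.+ suc (h ℕ.+ h))
        q≡3+4h = ≡.trans order≡1+2squares (≡.cong suc (≡.cong₂ ℕ._+_ squares-odd squares-odd))

    sqrt-1-nonsquare : ¬ q % 8 ≡ 1 → ∀ {ζ} → sq F ζ ≈ - 1# → NonSquare ζ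
    sqrt-1-nonsquare q%8≢1 {ζ} ζ²≈-1 = ζ≉0 , q%8≢1 ∘ q%8≡1
      where
        ζ≉0 : ζ ≉ 0#
        ζ≉0 = square-root-≉0 (-‿≉0 1≉0) (sym ζ²≈-1)
        squares-neg : ∀ {x} → NonZeroSquare x → NonZeroSquare (- x)
        squares-neg (x≉0 , (y , x≈y²)) = -‿≉0 x≉0 , (ζ * y , -‿square ζ²≈-1 x≈y²)
        q%8≡1 : IsSquare ζ → q % 8 ≡ 1
        q%8≡1 ζ-square = ≡.trans (≡.cong (_% 8) q≡1+8h) ([1+2[2[2m]]]%8≡1 h)
          where
            fourthPowers : Decidable (SquaresOf NonZeroSquare)
            fourthPowers = SquaresOf? NonZeroSquare-resp NonZeroSquare?
            fourthPowers-≉0 : ∀ {x} → SquaresOf NonZeroSquare x → x ≉ 0#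
            fourthPowers-≉0 (y , (y≉0 , _) , x≈y²) = square-≉0 y≉0 x≈y²
            fourthPowers-neg : ∀ {x} → SquaresOf NonZeroSquare x → SquaresOf NonZeroSquare (- x)
            fourthPowers-neg (y , y-square , x≈y²) = ζ * y , NonZeroSquare-* (ζ≉0 , ζ-square) y-square , -‿square ζ²≈-1 x≈y²
            h : ℕ
            h = ∣ fourthPowers ∩? Positive? ∣
            fourthPowers≡2h : ∣ fourthPowers ∣ ≡ h ℕ.+ h
            fourthPowers≡2h = negation-halves fourthPowers SquaresOf-resp fourthPowers-≉0 fourthPowers-neg
            squares≡4h : ∣ NonZeroSquare? ∣ ≡ (h ℕ.+ h) ℕ.+ (h ℕ.+ h)
            squares≡4h = ≡.trans (squaring-halves NonZeroSquare? NonZeroSquare-resp proj₁ squares-neg)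
                                 (≡.cong₂ ℕ._+_ fourthPowers≡2h fourthPowers≡2h)
            q≡1+8h : q ≡ suc ((h ℕ.+ h ℕ.+ (h ℕ.+ h)) ℕ.+ (h ℕ.+ h ℕ.+ (h ℕ.+ h)))
            q≡1+8h = ≡.trans order≡1+2squares (≡.cong suc (≡.cong₂ ℕ._+_ squares≡4h squares≡4h))

    square-classes : ∀ {n} → NonSquare n → ∀ {x} → x ≉ 0# → IsSquare x ⊎ IsSquare (n * x)
    square-classes n-nonsquare {x} x≉0 with IsSquare? x
    ... | yes x-square    = inj₁ x-square
    ... | no x-nonsquare  = inj₂ (nonsquare-mul n-nonsquare (x≉0 , x-nonsquare))

-- Only |F| = q ≡ 5 (mod 8) is used: the prime-power hypothesis is redundant.
corollary3p3 : ∀ {c ℓ} (F : CommutativeRing c ℓ) → IsField F →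
    (q : ℕ) → IsPrimePower q → q % 8 ≡ 5 → HasCard F q →
    ∀ k → AdvInf F k ⇔ (T F k × IsFourthPower F (CommutativeRing._*_ F (CommutativeRing._*_ F (four F) k) (sq F (CommutativeRing._+_ F (CommutativeRing.1# F) k))))
corollary3p3 F isField q _ q%8≡5 card k =
  mk⇔ (λ adv → Adv₂⇒Δ-fourthPower (adv 2))
      (λ (Tk , Δk-fourthPower) n →
         squareSuccessor⇒Adv ζ ζ²≈-1 (square-classes two≉0 ζ-nonsquare) n
           (Δ-fourthPower⇒squareSuccessor Tk Δk-fourthPower))
  where
    open CommutativeRing F
    open Field F isField
    open FiniteField F isField card

    q%2≡1 : q % 2 ≡ 1
    q%2≡1 = ≡.trans (≡.sym (m∣n⇒o%n%m≡o%m 2 8 q (divides 4 ≡.refl))) (≡.cong (_% 2) q%8≡5)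

    q%4≡1 : q % 4 ≡ 1
    q%4≡1 = ≡.trans (≡.sym (m∣n⇒o%n%m≡o%m 4 8 q (divides 2 ≡.refl))) (≡.cong (_% 4) q%8≡5)

    q%8≢1 : ¬ q % 8 ≡ 1
    q%8≢1 q%8≡1 with ≡.trans (≡.sym q%8≡5) q%8≡1
    ... | ()

    two≉0 : two F ≉ 0#
    two≉0 = odd-order⇒two≉0 q%2≡1

    open Advancement F isField two≉0

    ζ : Carrier
    ζ = proj₁ (-1-square two≉0 q%4≡1)

    ζ²≈-1 : sq F ζ ≈ - 1#
    ζ²≈-1 = sym (proj₂ (-1-square two≉0 q%4≡1))

    ζ-nonsquare : NonSquare ζ
    ζ-nonsquare = sqrt-1-nonsquare two≉0 q%8≢1 ζ²≈-1
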